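{- For every $n\geq1$, the lattice $\mathcal{L}_n$ is order-isomorphic to the subset $\mathcal{L}_n^{\downarrow_1}=\{\vec\alpha^{\downarrow_1}:\vec\alpha\in\mathcal{L}_n\}$ of $\mathcal{L}_{n+1}$ equipped with the induced dominance ordering; an isomorphism is given by $\vec\alpha\mapsto\vec\alpha^{\downarrow_1}$.
   Context: A partition of a positive integer $n$ is an $n$-tuple $(a_1,\ldots,a_n)$ of natural numbers with $a_1\geq\cdots\geq a_n\geq0$ and $\sum a_i=n$. The dominance ordering: $(a_i)\geq(b_i)$ iff $\sum_{i=1}^j a_i\geq\sum_{i=1}^j b_i$ for all $j\geq1$; the partitions of $n$ with this order form the lattice $\mathcal{L}_n$. For $\vec\alpha=(a_1,\ldots,a_n)$, $\vec\alpha^{\downarrow_1}=(a_1+1,a_2,\ldots,a_n,0)$, a partition of $n+1$. -}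

module Defs where

open import Data.Nat using (ℕ; zero; suc; _+_; _≤_)
open import Data.Fin using (Fin) renaming (_≤_ to _≤ᶠ_)
open import Data.Vec using (Vec; []; _∷_; lookup; sum; _∷ʳ_)
open import Data.Product using (_×_)
open import Relation.Binary.PropositionalEquality using (_≡_)

IsPartition : (n : ℕ) → Vec ℕ n → Set
IsPartition n v =
  (∀ (i j : Fin n) → i ≤ᶠ j → lookup v j ≤ lookup v i) × (sum v ≡ n)

-- prefix sum  ∑_{i=1}^{j} a_i  (entries beyond the length count as 0)
psum : ∀ {n} → ℕ → Vec ℕ n → ℕ
psum zero    v        = 0
psum (suc j) []       = 0
psum (suc j) (a ∷ v)  = a + psum j v

_≥ᵈ_ : ∀ {n} → Vec ℕ n → Vec ℕ n → Set
α ≥ᵈ β = ∀ (j : ℕ) → 1 ≤ j → psum j β ≤ psum j α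

down1 : ∀ {m} → Vec ℕ (suc m) → Vec ℕ (suc (suc m))
down1 (a ∷ v) = (suc a ∷ v) ∷ʳ 0

{-# OPTIONS --safe #-}
module Submission where

-- Adding a box to the first row keeps the row lengths non-increasing (the first
-- row only gets longer), and appending an empty row changes neither the
-- monotonicity nor any prefix sum. So every prefix sum of α^{↓1} of positive
-- length is the corresponding prefix sum of α plus one, and dominance is both
-- preserved and reflected; neither this nor injectivity needs α, β to be partitions.

open import Defs
open import Data.Nat using (ℕ; suc; zero; _≤_; z≤n; s≤s; s≤s⁻¹; _+_)
open import Data.Nat.Properties using (≤-refl; m≤n⇒m≤1+n; suc-injective)
open import Data.Fin using (Fin) renaming (zero to fzero; suc to fsuc; _≤_ to _≤ᶠ_)
open import Data.Vec using (Vec; []; _∷_; lookup; sum; _∷ʳ_)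
open import Data.Vec.Properties using (∷ʳ-injectiveˡ; ∷-injective)
open import Data.Product using (_×_; _,_)
open import Function.Bundles using (_⇔_; mk⇔)
open import Relation.Binary.PropositionalEquality using (_≡_; refl; cong; trans)

Antitone : ∀ {n} → Vec ℕ n → Set
Antitone {n} v = ∀ (i j : Fin n) → i ≤ᶠ j → lookup v j ≤ lookup v i

UpperBound : ∀ {n} → ℕ → Vec ℕ n → Set
UpperBound {n} a v = ∀ (j : Fin n) → lookup v j ≤ a

antitone-tail : ∀ {n} {a} {v : Vec ℕ n} → Antitone (a ∷ v) → Antitone v
antitone-tail d i j i≤j = d (fsuc i) (fsuc j) (s≤s i≤j)

antitone-head-bound : ∀ {n} {a} {v : Vec ℕ n} → Antitone (a ∷ v) → UpperBound a v
antitone-head-bound d j = d fzero (fsuc j) z≤n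

antitone-∷ : ∀ {n} {a} {v : Vec ℕ n} → UpperBound a v → Antitone v → Antitone (a ∷ v)
antitone-∷ b d fzero    fzero    _         = ≤-refl
antitone-∷ b d fzero    (fsuc j) _         = b j
antitone-∷ b d (fsuc i) (fsuc j) (s≤s i≤j) = d i j i≤j

antitone-suc-head : ∀ {n} {a} {v : Vec ℕ n} → Antitone (a ∷ v) → Antitone (suc a ∷ v)
antitone-suc-head d =
  antitone-∷ (λ j → m≤n⇒m≤1+n (antitone-head-bound d j)) (antitone-tail d)

upperBound-∷ʳ-0 : ∀ {n} {a} (v : Vec ℕ n) → UpperBound a v → UpperBound a (v ∷ʳ 0)
upperBound-∷ʳ-0 []      b fzero    = z≤n
upperBound-∷ʳ-0 (x ∷ v) b fzero    = b fzero
upperBound-∷ʳ-0 (x ∷ v) b (fsuc j) = upperBound-∷ʳ-0 v (λ k → b (fsuc k)) j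

antitone-∷ʳ-0 : ∀ {n} (v : Vec ℕ n) → Antitone v → Antitone (v ∷ʳ 0)
antitone-∷ʳ-0 []      d fzero fzero _ = z≤n
antitone-∷ʳ-0 (a ∷ v) d =
  antitone-∷ (upperBound-∷ʳ-0 v (antitone-head-bound d)) (antitone-∷ʳ-0 v (antitone-tail d))

sum-∷ʳ-0 : ∀ {n} (v : Vec ℕ n) → sum (v ∷ʳ 0) ≡ sum v
sum-∷ʳ-0 []      = refl
sum-∷ʳ-0 (a ∷ v) = cong (a +_) (sum-∷ʳ-0 v)

psum-∷ʳ-0 : ∀ {n} j (v : Vec ℕ n) → psum j (v ∷ʳ 0) ≡ psum j v
psum-∷ʳ-0 zero          v       = refl
psum-∷ʳ-0 (suc zero)    []      = refl
psum-∷ʳ-0 (suc (suc j)) []      = refl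
psum-∷ʳ-0 (suc j)       (a ∷ v) = cong (a +_) (psum-∷ʳ-0 j v)

psum-down1 : ∀ {m} j (α : Vec ℕ (suc m)) → psum (suc j) (down1 α) ≡ suc (psum (suc j) α)
psum-down1 j (a ∷ v) = cong (λ s → suc (a + s)) (psum-∷ʳ-0 j v)

down1-isPartition : ∀ {m} (α : Vec ℕ (suc m)) →
  IsPartition (suc m) α → IsPartition (suc (suc m)) (down1 α)
down1-isPartition (a ∷ v) (d , Σα≡n) =
  antitone-∷ʳ-0 (suc a ∷ v) (antitone-suc-head d) , trans (sum-∷ʳ-0 (suc a ∷ v)) (cong suc Σα≡n)

down1-injective : ∀ {m} (α β : Vec ℕ (suc m)) → down1 α ≡ down1 β → α ≡ β
down1-injective (a ∷ v) (b ∷ w) eq with ∷-injective (∷ʳ-injectiveˡ (suc a ∷ v) (suc b ∷ w) eq)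
... | 1+a≡1+b , refl = cong (_∷ v) (suc-injective 1+a≡1+b)

down1-≥ᵈ-⇔ : ∀ {m} (α β : Vec ℕ (suc m)) → (α ≥ᵈ β) ⇔ (down1 α ≥ᵈ down1 β)
down1-≥ᵈ-⇔ α β = mk⇔ preserve reflect
  where
  preserve : α ≥ᵈ β → down1 α ≥ᵈ down1 β
  preserve α≥β (suc j) _ rewrite psum-down1 j α | psum-down1 j β = s≤s (α≥β (suc j) (s≤s z≤n))

  reflect : down1 α ≥ᵈ down1 β → α ≥ᵈ β
  reflect α↓≥β↓ (suc j) _ with α↓≥β↓ (suc j) (s≤s z≤n)
  ... | le rewrite psum-down1 j α | psum-down1 j β = s≤s⁻¹ le

lemma1 : ∀ (m : ℕ) →
    ((α : Vec ℕ (suc m)) → IsPartition (suc m) α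
      → IsPartition (suc (suc m)) (down1 α))
    × ((α β : Vec ℕ (suc m)) → IsPartition (suc m) α → IsPartition (suc m) β
      → down1 α ≡ down1 β → α ≡ β)
    × ((α β : Vec ℕ (suc m)) → IsPartition (suc m) α → IsPartition (suc m) β
      → (α ≥ᵈ β) ⇔ (down1 α ≥ᵈ down1 β))
lemma1 m =
    down1-isPartition
  , (λ α β _ _ → down1-injective α β)
  , (λ α β _ _ → down1-≥ᵈ-⇔ α β)
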